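{- Consider the $1024$ symmetric $3\times3\times3$ tensors over $\mathbb{F}_2$. Exactly $128$ of them are sums of simple symmetric tensors (including the zero tensor as the empty sum). Among these, the numbers of tensors of symmetric rank $0,1,2,3,4,5,6,7$ are $1,7,21,35,35,21,7,1$ respectively; in particular the maximum symmetric rank (over those tensors having a symmetric decomposition) is $7$.
   Context: A $3\times3\times3$ tensor $[x_{ijk}]$ is symmetric if $x_{i_{\pi(1)}i_{\pi(2)}i_{\pi(3)}}=x_{i_1i_2i_3}$ for all permutations $\pi\in S_3$. A simple symmetric tensor is $u\otimes u\otimes u$ with $u\in\mathbb{F}_2^3$ nonzero, with entries $u_iu_ju_k$. The symmetric rank of a symmetric tensor $X$ is the least $s$ such that $X=\sum_{i=1}^s u_i^{\otimes 3}$ with the $u_i$ nonzero; the zero tensor has symmetric rank $0$. -}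

module Defs where

open import Data.Bool using (Bool; true; false; _xor_; _∧_)
open import Data.Nat using (ℕ; _<_)
open import Data.Fin using (Fin)
open import Data.Vec using (Vec; lookup; tabulate; zipWith; replicate; foldr)
open import Data.Vec.Relation.Unary.All using (All)
open import Data.List using (List; length)
open import Data.List.Membership.Propositional using (_∈_)
open import Data.List.Relation.Unary.Unique.Propositional using (Unique)
open import Data.Product using (Σ; ∃; _×_)
open import Function.Bundles using (_⇔_)
open import Relation.Binary.PropositionalEquality using (_≡_; _≢_)
open import Relation.Nullary using (¬_)

-- F₂ is modelled by Bool with _xor_ as addition and _∧_ as multiplication.

V3 : Set
V3 = Vec Bool 3

Tensor : Set
Tensor = Vec (Vec (Vec Bool 3) 3) 3

entry : Tensor → Fin 3 → Fin 3 → Fin 3 → Bool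
entry X i j k = lookup (lookup (lookup X i) j) k

Symmetric : Tensor → Set
Symmetric X = ∀ i j k →
  (entry X i j k ≡ entry X i k j) × (entry X i j k ≡ entry X j i k) ×
  (entry X i j k ≡ entry X j k i) × (entry X i j k ≡ entry X k i j) ×
  (entry X i j k ≡ entry X k j i)

zeroT : Tensor
zeroT = replicate 3 (replicate 3 (replicate 3 false))

_⊕_ : Tensor → Tensor → Tensor
X ⊕ Y = zipWith (zipWith (zipWith _xor_)) X Y

cube : V3 → Tensor
cube u = tabulate λ i → tabulate λ j → tabulate λ k →
  lookup u i ∧ (lookup u j ∧ lookup u k)

NonZero3 : V3 → Set
NonZero3 u = u ≢ replicate 3 false

sumCubes : ∀ {s} → Vec V3 s → Tensor
sumCubes us = foldr _ (λ u acc → cube u ⊕ acc) zeroT us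

HasSymDecomp : ℕ → Tensor → Set
HasSymDecomp s X = Σ (Vec V3 s) λ us → All NonZero3 us × sumCubes us ≡ X

IsSumOfSimple : Tensor → Set
IsSumOfSimple X = ∃ λ s → HasSymDecomp s X

SymRank : ℕ → Tensor → Set
SymRank r X = HasSymDecomp r X × (∀ s → s < r → ¬ HasSymDecomp s X)

HasExactly : ℕ → (Tensor → Set) → Set
HasExactly n P = Σ (List Tensor) λ xs →
  (length xs ≡ n) × Unique xs × (∀ X → (X ∈ xs) ⇔ P X)

rankCount : Fin 8 → ℕ
rankCount r = lookup (1 Data.Vec.∷ 7 Data.Vec.∷ 21 Data.Vec.∷ 35 Data.Vec.∷ 35 Data.Vec.∷ 21 Data.Vec.∷ 7 Data.Vec.∷ 1 Data.Vec.∷ Data.Vec.[]) r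

-- Over F₂ we have u⊗³ + u⊗³ = 0, so a sum of cubes equals the sum of u⊗³ over the set of
-- vectors u occurring an odd number of times, which is no longer than the original sum. The
-- seven cubes u⊗³ (u ≠ 0) are linearly independent in the ten-dimensional space of symmetric
-- tensors, so different subsets of nonzero vectors give different tensors. Hence the sums of
-- cubes correspond exactly to the 2⁷ subsets of F₂³ ∖ {0}, the symmetric rank of such a sum is
-- the size of its subset, and there are C(7, r) tensors of rank r.
module Submission where

open import Defs
open import Data.Nat using (_<_)
open import Data.Fin using (Fin; toℕ)
open import Data.Product using (_×_; ∃)
open import Relation.Nullary using (¬_)

open import Data.Bool using (Bool; true; false; _xor_) renaming (_≟_ to _≟ᵇ_)
open import Data.Fin using (#_)
open import Data.Fin.Patterns using (0F; 1F; 2F)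
open import Data.Fin.Properties using (all?) renaming (_≟_ to _≟ᶠ_)
open import Data.Fin.Subset using (Subset; inside; outside; ∣_∣; ⊥; ⊤)
open import Data.Fin.Subset.Properties using (∣p∣≤n)
open import Data.List using (List; []; _∷_; _++_; map; filter; length)
open import Data.List.Properties using (filter-++; length-++; filter-none; filter-≐; length-map)
open import Data.List.Membership.Propositional using (_∈_)
open import Data.List.Membership.Propositional.Properties
  using (∈-map⁺; ∈-map⁻; ∈-++⁺ˡ; ∈-++⁺ʳ; ∈-filter⁺; ∈-filter⁻)
import Data.List.Relation.Unary.All as All
open import Data.List.Relation.Unary.Any using (here; there)
open import Data.List.Relation.Unary.Unique.Propositional as AllPairs using (Unique)
import Data.List.Relation.Unary.Unique.Propositional.Properties as Unique
open import Data.Nat using (ℕ; zero; suc; _+_; _≤_; z≤n; s≤s; _≟_; _≤?_)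
open import Data.Nat.Combinatorics using (_C_; nCk+nC[k+1]≡[n+1]C[k+1])
open import Data.Nat.Properties using (suc-injective; ≤-trans; ≤-antisym; ≮⇒≥; <-irrefl; <-≤-trans; <⇒≱)
open import Data.Product using (_,_; proj₁; proj₂)
open import Data.Product.Properties using (≡-dec)
open import Data.Vec as Vec using (Vec; []; _∷_; lookup; tabulate; zipWith)
open import Data.Vec.Properties
  using (∷-injectiveʳ; lookup∘tabulate; tabulate∘lookup; tabulate-cong; lookup-map)
  renaming (≡-dec to ≡-decᵛ)
import Data.Vec.Relation.Unary.All as Allᵛ
open import Function using (_∘_)
open import Function.Bundles using (mk⇔)
open import Function.Definitions using (Injective)
open import Relation.Binary.Definitions using (DecidableEquality)
open import Relation.Binary.PropositionalEquality using (_≡_; refl; sym; trans; cong; subst)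
open import Relation.Nullary using (Dec; does; map′; _×-dec_)
open import Relation.Nullary.Decidable using (from-yes)
open import Relation.Unary using (Pred; Decidable)

private variable
  n r s : ℕ
  X : Tensor

subsets : ∀ n → List (Subset n)
subsets zero = [] ∷ []
subsets (suc n) = map (inside ∷_) (subsets n) ++ map (outside ∷_) (subsets n)

∈-subsets : ∀ (p : Subset n) → p ∈ subsets n
∈-subsets [] = here refl
∈-subsets (inside ∷ p) = ∈-++⁺ˡ (∈-map⁺ (inside ∷_) (∈-subsets p))
∈-subsets (outside ∷ p) = ∈-++⁺ʳ _ (∈-map⁺ (outside ∷_) (∈-subsets p))

subsets-unique : ∀ n → Unique (subsets n)
subsets-unique zero = All.[] AllPairs.∷ AllPairs.[]
subsets-unique (suc n) = Unique.++⁺ (Unique.map⁺ ∷-injectiveʳ (subsets-unique n))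
  (Unique.map⁺ ∷-injectiveʳ (subsets-unique n)) heads-differ
  where
  heads-differ : ∀ {p} → ¬ (p ∈ map (inside ∷_) (subsets n) × p ∈ map (outside ∷_) (subsets n))
  heads-differ (p∈ , q∈) with ∈-map⁻ (inside ∷_) p∈ | ∈-map⁻ (outside ∷_) q∈
  ... | _ , _ , refl | _ , _ , ()

∀-subset? : ∀ {ℓ} {P : Pred (Subset n) ℓ} → Decidable P → Dec (∀ p → P p)
∀-subset? P? = map′ (λ ps p → All.lookup ps (∈-subsets p)) (λ ∀p → All.tabulate (λ {p} _ → ∀p p))
  (All.all? P? (subsets _))

sizeIs? : ∀ k (p : Subset n) → Dec (∣ p ∣ ≡ k)
sizeIs? k p = ∣ p ∣ ≟ k

ofSize : ℕ → List (Subset n) → List (Subset n)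
ofSize k = filter (sizeIs? k)

length-filter-map : ∀ {a b p} {A : Set a} {B : Set b} {P : Pred B p} (P? : Decidable P) (f : A → B) xs →
  length (filter P? (map f xs)) ≡ length (filter (P? ∘ f) xs)
length-filter-map P? f [] = refl
length-filter-map P? f (x ∷ xs) with does (P? (f x))
... | true = cong suc (length-filter-map P? f xs)
... | false = length-filter-map P? f xs

length-ofSize-subsets : ∀ n k → length (ofSize k (subsets n)) ≡ n C k
length-ofSize-subsets zero zero = refl
length-ofSize-subsets zero (suc k) = refl
length-ofSize-subsets (suc n) k
  rewrite filter-++ (sizeIs? k) (map (inside ∷_) (subsets n)) (map (outside ∷_) (subsets n))
        | length-++ (ofSize k (map (inside ∷_) (subsets n))) {ofSize k (map (outside ∷_) (subsets n))}
        | length-filter-map (sizeIs? k) (inside ∷_) (subsets n)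
        | length-filter-map (sizeIs? k) (outside ∷_) (subsets n)
        = pascal k
  where
  pascal : ∀ k → length (filter (λ p → suc ∣ p ∣ ≟ k) (subsets n)) + length (ofSize k (subsets n)) ≡ suc n C k
  pascal zero
    rewrite filter-none (λ p → suc ∣ p ∣ ≟ zero) (All.tabulate {xs = subsets n} (λ _ ()))
    = length-ofSize-subsets n zero
  pascal (suc k)
    rewrite filter-≐ (λ p → suc ∣ p ∣ ≟ suc k) (λ p → ∣ p ∣ ≟ k) (suc-injective , cong suc) (subsets n)
          | length-ofSize-subsets n k
          | length-ofSize-subsets n (suc k)
    = nCk+nC[k+1]≡[n+1]C[k+1] n k

select : ∀ {a} {A : Set a} (p : Subset n) → Vec A n → Vec A ∣ p ∣
select [] [] = []
select (inside ∷ p) (x ∷ xs) = x ∷ select p xs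
select (outside ∷ p) (x ∷ xs) = select p xs

All-select : ∀ {a ℓ} {A : Set a} {P : A → Set ℓ} (p : Subset n) {xs : Vec A n} →
  Allᵛ.All P xs → Allᵛ.All P (select p xs)
All-select [] Allᵛ.[] = Allᵛ.[]
All-select (inside ∷ p) (px Allᵛ.∷ pxs) = px Allᵛ.∷ All-select p pxs
All-select (outside ∷ p) (px Allᵛ.∷ pxs) = All-select p pxs

hasExactly-image : ∀ {a} {A : Set a} {P : Tensor → Set} (xs : List A) (f : A → Tensor) →
  Unique xs → Injective _≡_ _≡_ f →
  (∀ x → x ∈ xs → P (f x)) → (∀ X → P X → ∃ λ x → x ∈ xs × X ≡ f x) →
  HasExactly (length xs) P
hasExactly-image {P = P} xs f unique injective sound complete =
  map f xs , length-map f xs , Unique.map⁺ injective unique , λ X → mk⇔ (to X) (from X)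
  where
  to : ∀ X → X ∈ map f xs → P X
  to X X∈ with ∈-map⁻ f X∈
  ... | x , x∈ , refl = sound x x∈
  from : ∀ X → P X → X ∈ map f xs
  from X PX with complete X PX
  ... | x , x∈ , refl = ∈-map⁺ f x∈

infix 4 _≟ᵀ_ _≟ᴵ_

_≟ᵀ_ : DecidableEquality Tensor
_≟ᵀ_ = ≡-decᵛ (≡-decᵛ (≡-decᵛ _≟ᵇ_))

entry-tabulate : ∀ (f : Fin 3 → Fin 3 → Fin 3 → Bool) i j k →
  entry (tabulate λ i → tabulate λ j → tabulate λ k → f i j k) i j k ≡ f i j k
entry-tabulate f i j k
  rewrite lookup∘tabulate (λ i → tabulate λ j → tabulate λ k → f i j k) i
        | lookup∘tabulate (λ j → tabulate λ k → f i j k) j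
        = lookup∘tabulate (f i j) k

tensor-ext : ∀ {X Y : Tensor} → (∀ i j k → entry X i j k ≡ entry Y i j k) → X ≡ Y
tensor-ext X≗Y = vec-ext λ i → vec-ext λ j → vec-ext λ k → X≗Y i j k
  where
  vec-ext : ∀ {A : Set} {n} {xs ys : Vec A n} → (∀ i → lookup xs i ≡ lookup ys i) → xs ≡ ys
  vec-ext {xs = xs} {ys} xs≗ys =
    trans (sym (tabulate∘lookup xs)) (trans (tabulate-cong xs≗ys) (tabulate∘lookup ys))

Index : Set
Index = Fin 3 × Fin 3 × Fin 3

_≟ᴵ_ : DecidableEquality Index
_≟ᴵ_ = ≡-dec _≟ᶠ_ (≡-dec _≟ᶠ_ _≟ᶠ_)

open import Data.List.Membership.DecPropositional _≟ᴵ_ using (_∈?_)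

entryAt : Tensor → Index → Bool
entryAt X (i , j , k) = entry X i j k

-- The sorted index triples i ≤ j ≤ k, one per multiset; monomialIndex i j k is the position of
-- the multiset {i, j, k} in this list.
monomials : Vec Index 10
monomials = (# 0 , # 0 , # 0) ∷ (# 0 , # 0 , # 1) ∷ (# 0 , # 0 , # 2) ∷ (# 0 , # 1 , # 1) ∷ (# 0 , # 1 , # 2) ∷
            (# 0 , # 2 , # 2) ∷ (# 1 , # 1 , # 1) ∷ (# 1 , # 1 , # 2) ∷ (# 1 , # 2 , # 2) ∷ (# 2 , # 2 , # 2) ∷ []

monomialIndex : Fin 3 → Fin 3 → Fin 3 → Fin 10
monomialIndex i j k = lookup (lookup (lookup table i) j) k
  where
  table : Vec (Vec (Vec (Fin 10) 3) 3) 3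
  table = ((# 0 ∷ # 1 ∷ # 2 ∷ []) ∷ (# 1 ∷ # 3 ∷ # 4 ∷ []) ∷ (# 2 ∷ # 4 ∷ # 5 ∷ []) ∷ []) ∷
          ((# 1 ∷ # 3 ∷ # 4 ∷ []) ∷ (# 3 ∷ # 6 ∷ # 7 ∷ []) ∷ (# 4 ∷ # 7 ∷ # 8 ∷ []) ∷ []) ∷
          ((# 2 ∷ # 4 ∷ # 5 ∷ []) ∷ (# 4 ∷ # 7 ∷ # 8 ∷ []) ∷ (# 5 ∷ # 8 ∷ # 9 ∷ []) ∷ []) ∷ []

monomialIndex-symmetric : ∀ i j k →
  (monomialIndex i j k ≡ monomialIndex i k j) × (monomialIndex i j k ≡ monomialIndex j i k) ×
  (monomialIndex i j k ≡ monomialIndex j k i) × (monomialIndex i j k ≡ monomialIndex k i j) ×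
  (monomialIndex i j k ≡ monomialIndex k j i)
monomialIndex-symmetric = from-yes (all? λ i → all? λ j → all? λ k →
  (m i j k ≟ᶠ m i k j) ×-dec (m i j k ≟ᶠ m j i k) ×-dec (m i j k ≟ᶠ m j k i) ×-dec
  (m i j k ≟ᶠ m k i j) ×-dec (m i j k ≟ᶠ m k j i))
  where m = monomialIndex

-- The order matches the components of Symmetric.
permutations : Index → List Index
permutations (i , j , k) = (i , j , k) ∷ (i , k , j) ∷ (j , i , k) ∷ (j , k , i) ∷ (k , i , j) ∷ (k , j , i) ∷ []

monomial-∈-permutations : ∀ i j k → lookup monomials (monomialIndex i j k) ∈ permutations (i , j , k)
monomial-∈-permutations = from-yes (all? λ i → all? λ j → all? λ k →
  lookup monomials (monomialIndex i j k) ∈? permutations (i , j , k))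

symmetric-permutation : ∀ X → Symmetric X → ∀ {i j k t} → t ∈ permutations (i , j , k) → entryAt X t ≡ entry X i j k
symmetric-permutation X S (here refl) = refl
symmetric-permutation X S {i} {j} {k} (there (here refl)) = sym (proj₁ (S i j k))
symmetric-permutation X S {i} {j} {k} (there (there (here refl))) = sym (proj₁ (proj₂ (S i j k)))
symmetric-permutation X S {i} {j} {k} (there (there (there (here refl)))) = sym (proj₁ (proj₂ (proj₂ (S i j k))))
symmetric-permutation X S {i} {j} {k} (there (there (there (there (here refl))))) =
  sym (proj₁ (proj₂ (proj₂ (proj₂ (S i j k)))))
symmetric-permutation X S {i} {j} {k} (there (there (there (there (there (here refl)))))) =
  sym (proj₂ (proj₂ (proj₂ (proj₂ (S i j k)))))

fromCoefficients : Vec Bool 10 → Tensor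
fromCoefficients c = tabulate λ i → tabulate λ j → tabulate λ k → lookup c (monomialIndex i j k)

entry-fromCoefficients : ∀ c i j k → entry (fromCoefficients c) i j k ≡ lookup c (monomialIndex i j k)
entry-fromCoefficients c = entry-tabulate λ i j k → lookup c (monomialIndex i j k)

coefficients : Tensor → Vec Bool 10
coefficients X = Vec.map (entryAt X) monomials

coefficients-fromCoefficients : ∀ c → coefficients (fromCoefficients c) ≡ c
coefficients-fromCoefficients (c₀ ∷ c₁ ∷ c₂ ∷ c₃ ∷ c₄ ∷ c₅ ∷ c₆ ∷ c₇ ∷ c₈ ∷ c₉ ∷ []) = refl

fromCoefficients-injective : Injective _≡_ _≡_ fromCoefficients
fromCoefficients-injective {c} {d} e =
  trans (sym (coefficients-fromCoefficients c)) (trans (cong coefficients e) (coefficients-fromCoefficients d))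

fromCoefficients-symmetric : ∀ c → Symmetric (fromCoefficients c)
fromCoefficients-symmetric c i j k =
  let e₁ , e₂ , e₃ , e₄ , e₅ = monomialIndex-symmetric i j k
  in via i k j e₁ , via j i k e₂ , via j k i e₃ , via k i j e₄ , via k j i e₅
  where
  via : ∀ a b d → monomialIndex i j k ≡ monomialIndex a b d →
        entry (fromCoefficients c) i j k ≡ entry (fromCoefficients c) a b d
  via a b d e =
    trans (entry-fromCoefficients c i j k) (trans (cong (lookup c) e) (sym (entry-fromCoefficients c a b d)))

fromCoefficients-coefficients : Symmetric X → fromCoefficients (coefficients X) ≡ X
fromCoefficients-coefficients {X} S = tensor-ext λ i j k →
  trans (entry-fromCoefficients (coefficients X) i j k)
    (trans (lookup-map (monomialIndex i j k) (entryAt X) monomials)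
      (symmetric-permutation X S (monomial-∈-permutations i j k)))

symmetricTensors : HasExactly 1024 Symmetric
symmetricTensors = hasExactly-image {P = Symmetric}
  (subsets 10) fromCoefficients (subsets-unique 10) fromCoefficients-injective
  (λ c _ → fromCoefficients-symmetric c)
  (λ X S → coefficients X , ∈-subsets (coefficients X) , sym (fromCoefficients-coefficients S))

nonzeroVectors : Vec V3 7
nonzeroVectors =
  (true ∷ false ∷ false ∷ []) ∷ (false ∷ true ∷ false ∷ []) ∷ (false ∷ false ∷ true ∷ []) ∷
  (true ∷ true ∷ false ∷ []) ∷ (true ∷ false ∷ true ∷ []) ∷ (false ∷ true ∷ true ∷ []) ∷
  (true ∷ true ∷ true ∷ []) ∷ []

cubeSum : Subset 7 → Tensor
cubeSum p = sumCubes (select p nonzeroVectors)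

hasSymDecomp-cubeSum : ∀ p → HasSymDecomp ∣ p ∣ (cubeSum p)
hasSymDecomp-cubeSum p = select p nonzeroVectors , All-select p nonzero , refl
  where
  nonzero : Allᵛ.All NonZero3 nonzeroVectors
  nonzero = (λ ()) Allᵛ.∷ (λ ()) Allᵛ.∷ (λ ()) Allᵛ.∷ (λ ()) Allᵛ.∷ (λ ()) Allᵛ.∷ (λ ()) Allᵛ.∷ (λ ()) Allᵛ.∷ Allᵛ.[]

-- Flips the membership of u; for u = 0 (not in nonzeroVectors) it does nothing, matching cube 0 = 0.
toggle : V3 → Subset 7 → Subset 7
toggle u = zipWith _xor_ (Vec.map (λ v → does (≡-decᵛ _≟ᵇ_ v u)) nonzeroVectors)

cube-⊕-cubeSum : ∀ u p → cube u ⊕ cubeSum p ≡ cubeSum (toggle u p)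
cube-⊕-cubeSum = from-yes (∀-subset? λ u → ∀-subset? λ p → cube u ⊕ cubeSum p ≟ᵀ cubeSum (toggle u p))

∣toggle∣≤ : ∀ u p → ∣ toggle u p ∣ ≤ suc ∣ p ∣
∣toggle∣≤ = from-yes (∀-subset? λ u → ∀-subset? λ p → ∣ toggle u p ∣ ≤? suc ∣ p ∣)

-- The entry x_abc of cubeSum p is the parity of the number of u ∈ p whose support contains
-- {a, b, c}. Reading off x_0, x_1, x_2, x_01, x_02, x_12, x_012 and inverting these upward sums
-- over the lattice of supports (Möbius inversion mod 2) recovers p.
cubeCoordinates : Tensor → Subset 7
cubeCoordinates X =
  (x₀ xor x₀₁ xor x₀₂ xor x₀₁₂) ∷ (x₁ xor x₀₁ xor x₁₂ xor x₀₁₂) ∷ (x₂ xor x₀₂ xor x₁₂ xor x₀₁₂) ∷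
  (x₀₁ xor x₀₁₂) ∷ (x₀₂ xor x₀₁₂) ∷ (x₁₂ xor x₀₁₂) ∷ x₀₁₂ ∷ []
  where
  x₀ = entry X 0F 0F 0F
  x₁ = entry X 1F 1F 1F
  x₂ = entry X 2F 2F 2F
  x₀₁ = entry X 0F 0F 1F
  x₀₂ = entry X 0F 0F 2F
  x₁₂ = entry X 1F 1F 2F
  x₀₁₂ = entry X 0F 1F 2F

cubeCoordinates-cubeSum : ∀ p → cubeCoordinates (cubeSum p) ≡ p
cubeCoordinates-cubeSum = from-yes (∀-subset? λ p → ≡-decᵛ _≟ᵇ_ (cubeCoordinates (cubeSum p)) p)

cubeSum-injective : Injective _≡_ _≡_ cubeSum
cubeSum-injective {p} {q} e =
  trans (sym (cubeCoordinates-cubeSum p)) (trans (cong cubeCoordinates e) (cubeCoordinates-cubeSum q))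

cubeSum-symmetric : ∀ p → Symmetric (cubeSum p)
cubeSum-symmetric p =
  subst Symmetric (fromCoefficients-coefficients-cubeSum p) (fromCoefficients-symmetric (coefficients (cubeSum p)))
  where
  fromCoefficients-coefficients-cubeSum : ∀ p → fromCoefficients (coefficients (cubeSum p)) ≡ cubeSum p
  fromCoefficients-coefficients-cubeSum =
    from-yes (∀-subset? λ p → fromCoefficients (coefficients (cubeSum p)) ≟ᵀ cubeSum p)

support : Vec V3 s → Subset 7
support [] = ⊥
support (u ∷ us) = toggle u (support us)

sumCubes≡cubeSum-support : ∀ (us : Vec V3 s) → sumCubes us ≡ cubeSum (support us)
sumCubes≡cubeSum-support [] = refl
sumCubes≡cubeSum-support (u ∷ us) =
  trans (cong (cube u ⊕_) (sumCubes≡cubeSum-support us)) (cube-⊕-cubeSum u (support us))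

∣support∣≤ : ∀ (us : Vec V3 s) → ∣ support us ∣ ≤ s
∣support∣≤ [] = z≤n
∣support∣≤ (u ∷ us) = ≤-trans (∣toggle∣≤ u (support us)) (s≤s (∣support∣≤ us))

sumOfSimple⇒cubeSum : IsSumOfSimple X → ∃ λ p → X ≡ cubeSum p
sumOfSimple⇒cubeSum (_ , us , _ , sum≡) = support us , trans (sym sum≡) (sumCubes≡cubeSum-support us)

cubeSum-minimal : ∀ p → HasSymDecomp s (cubeSum p) → ∣ p ∣ ≤ s
cubeSum-minimal {s} p (us , _ , sum≡) =
  subst (_≤ s) (cong ∣_∣ (cubeSum-injective {support us} {p} (trans (sym (sumCubes≡cubeSum-support us)) sum≡)))
    (∣support∣≤ us)

symRank-cubeSum : ∀ p → SymRank ∣ p ∣ (cubeSum p)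
symRank-cubeSum p = hasSymDecomp-cubeSum p , λ s s<∣p∣ d → <-irrefl refl (<-≤-trans s<∣p∣ (cubeSum-minimal p d))

symRank-unique : SymRank r X → SymRank s X → r ≡ s
symRank-unique (dr , minr) (ds , mins) = ≤-antisym (≮⇒≥ λ s<r → minr _ s<r ds) (≮⇒≥ λ r<s → mins _ r<s dr)

symRank⇒cubeSum : SymRank r X → ∃ λ p → ∣ p ∣ ≡ r × X ≡ cubeSum p
symRank⇒cubeSum rank@((us , _ , sum≡) , _) =
  support us , symRank-unique (subst (SymRank _) (sym X≡) (symRank-cubeSum (support us))) rank , X≡
  where X≡ = trans (sym sum≡) (sumCubes≡cubeSum-support us)

symRank≤7 : SymRank r X → r ≤ 7
symRank≤7 rank = let p , ∣p∣≡r , _ = symRank⇒cubeSum rank in subst (_≤ 7) ∣p∣≡r (∣p∣≤n p)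

symmetricSumsOfCubes : HasExactly 128 (λ X → Symmetric X × IsSumOfSimple X)
symmetricSumsOfCubes = hasExactly-image {P = λ X → Symmetric X × IsSumOfSimple X}
  (subsets 7) cubeSum (subsets-unique 7) cubeSum-injective
  (λ p _ → cubeSum-symmetric p , ∣ p ∣ , hasSymDecomp-cubeSum p)
  (λ X (_ , sum) → let p , X≡ = sumOfSimple⇒cubeSum sum in p , ∈-subsets p , X≡)

symmetricOfRank : ∀ r → HasExactly (7 C r) (λ X → Symmetric X × SymRank r X)
symmetricOfRank r = subst (λ n → HasExactly n (λ X → Symmetric X × SymRank r X)) (length-ofSize-subsets 7 r)
  (hasExactly-image {P = λ X → Symmetric X × SymRank r X}
    (ofSize r (subsets 7)) cubeSum (Unique.filter⁺ (sizeIs? r) (subsets-unique 7)) cubeSum-injective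
    (λ p p∈ → cubeSum-symmetric p ,
      subst (λ r → SymRank r (cubeSum p)) (proj₂ (∈-filter⁻ (sizeIs? r) {xs = subsets 7} p∈)) (symRank-cubeSum p))
    (λ X (_ , rank) → let p , ∣p∣≡r , X≡ = symRank⇒cubeSum rank in
      p , ∈-filter⁺ (sizeIs? r) (∈-subsets p) ∣p∣≡r , X≡))

rankCount≡7C : ∀ r → rankCount r ≡ 7 C toℕ r
rankCount≡7C = from-yes (all? λ r → rankCount r ≟ 7 C toℕ r)

mainTheorem4 : HasExactly 1024 Symmetric ×
    HasExactly 128 (λ X → Symmetric X × IsSumOfSimple X) ×
    (∀ (r : Fin 8) → HasExactly (rankCount r) (λ X → Symmetric X × SymRank (toℕ r) X)) ×
    (∀ r → 7 < r → ∀ X → ¬ SymRank r X) ×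
    (∃ λ X → Symmetric X × SymRank 7 X)
mainTheorem4 =
  symmetricTensors ,
  symmetricSumsOfCubes ,
  (λ r → subst (λ n → HasExactly n (λ X → Symmetric X × SymRank (toℕ r) X)) (sym (rankCount≡7C r)) (symmetricOfRank (toℕ r))) ,
  (λ r 7<r X rank → <⇒≱ 7<r (symRank≤7 rank)) ,
  (cubeSum ⊤ , cubeSum-symmetric ⊤ , symRank-cubeSum ⊤)
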